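{- Let $T\in\mathbb W$ and $X\subseteq L(T)$. (1) Exactly one of the following holds: (a) there is $S\in\mathbb L(T)$ with $L(S)\subseteq X$; (b) there is $S\in\mathbb H(T)$ with $L(S)\cap X=\emptyset$. (2) $X\in\mathcal F(T)^+$ if and only if there is $S\in\mathbb L(T)$ with $L(S)\subseteq X$.
   Context: A tree is a partial order $(T,\le_T)$ with a least element (root) such that for each $t$ the set $\{s:s\le_T t\}$ is well ordered; $succ_T(t)$ is the set of immediate successors of $t$. A subtree of $T$ is a nonempty $S\subseteq T$ with $\{s\in S:s\le t\}=\{s\in T:s\le t\}$ for all $t\in S$. $T$ is well-founded if every branch (maximal linearly ordered subset) is finite; $L(T)$ is the set of leaves. $T$ is $\omega$-branching if every node is a leaf or has countably infinitely many immediate successors; $\mathbb W$ is the class of well-founded $\omega$-branching trees. For $T\in\mathbb W$, a Laver subtree is a subtree $S\in\mathbb W$ with $L(S)\subseteq L(T)$; a Hechler subtree is a Laver subtree $S$ with $succ_T(t)\setminus succ_S(t)$ finite for all $t\in S$; $\mathbb L(T)$, $\mathbb H(T)$ denote these sets. $\mathcal F(T)$ is the filter on $L(T)$ generated by $\{L(S):S\in\mathbb H(T)\}$, and $\mathcal F(T)^+$ is the family of $X\subseteq L(T)$ meeting every member of $\mathcal F(T)$. -}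

module Defs where

open import Level using (Level; 0ℓ) renaming (suc to lsuc)
open import Data.Nat using (ℕ; _<_)
open import Data.Fin using (Fin)
open import Data.List using (List; []; _∷_; _++_; _∷ʳ_)
open import Data.Product using (Σ; ∃; _×_; _,_)
open import Data.Sum using (_⊎_)
open import Data.Unit using (⊤)
open import Data.Empty using (⊥)
open import Relation.Nullary using (¬_)

-- Well-founded ω-branching trees (the class 𝕎), up to isomorphism:
-- every node is a leaf or has immediate successors indexed by ℕ;
-- well-foundedness (all branches finite) is built in by inductivity.

data Tree : Set where
  leaf : Tree
  node : (ℕ → Tree) → Tree

-- Nodes of a tree are addressed by their path from the root
-- (a list of successor indices); p ∷ʳ n is the n-th immediate
-- successor of p, and p ≤ p ++ q.

NodeOf : Tree → List ℕ → Set
NodeOf T        []      = ⊤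
NodeOf leaf     (n ∷ p) = ⊥
NodeOf (node f) (n ∷ p) = NodeOf (f n) p

LeafOf : Tree → List ℕ → Set
LeafOf leaf     []      = ⊤
LeafOf (node f) []      = ⊥
LeafOf leaf     (n ∷ p) = ⊥
LeafOf (node f) (n ∷ p) = LeafOf (f n) p

Pred : Set₁
Pred = List ℕ → Set

Finite : (ℕ → Set) → Set
Finite P = ∃ λ m → ∀ n → P n → n < m

Infinite : (ℕ → Set) → Set
Infinite P = ¬ Finite P

IsSubtree : Tree → Pred → Set
IsSubtree T S =
  (∃ λ p → S p) ×
  (∀ p → S p → NodeOf T p) ×
  (∀ p q → S (p ++ q) → S p)

LeafIn : Pred → List ℕ → Set
LeafIn S p = S p × (∀ n → ¬ S (p ∷ʳ n))

-- S is ω-branching (S ⊆ T, so S is automatically well-founded)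
OmegaBranching : Pred → Set
OmegaBranching S =
  ∀ p → S p → (∀ n → ¬ S (p ∷ʳ n)) ⊎ Infinite (λ n → S (p ∷ʳ n))

IsLaver : Tree → Pred → Set
IsLaver T S =
  IsSubtree T S × OmegaBranching S × (∀ p → LeafIn S p → LeafOf T p)

IsHechler : Tree → Pred → Set
IsHechler T S =
  IsLaver T S ×
  (∀ p → S p → Finite (λ n → NodeOf T (p ∷ʳ n) × ¬ S (p ∷ʳ n)))

SubsetOfLeaves : Tree → Pred → Set
SubsetOfLeaves T X = ∀ p → X p → LeafOf T p

-- 𝓕(T): the filter on L(T) generated by {L(S) : S ∈ ℍ(T)}, i.e. the
-- subsets of L(T) containing L(S₁) ∩ … ∩ L(Sₖ) for some k and
-- Hechler subtrees S₁,…,Sₖ (k = 0 gives L(T) itself).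
InFilter : Tree → Pred → Set₁
InFilter T Y =
  SubsetOfLeaves T Y ×
  Σ ℕ λ k → Σ (Fin k → Pred) λ Ss →
    (∀ i → IsHechler T (Ss i)) ×
    (∀ p → LeafOf T p → (∀ i → LeafIn (Ss i) p) → Y p)

InFilterPlus : Tree → Pred → Set₁
InFilterPlus T X =
  SubsetOfLeaves T X × (∀ Y → InFilter T Y → ∃ λ p → X p × Y p)

ExactlyOne : ∀ {a b} → Set a → Set b → Set _
ExactlyOne A B = (A ⊎ B) × ¬ (A × B)

module Submission where

-- Call X ⊆ L(T) Laver-large when T is a single leaf lying in X, or when
-- infinitely many immediate subtrees of T carry a Laver-large part of X.
-- If X is Laver-large, the nodes all of whose initial segments are
-- Laver-large form a Laver subtree with leaves in X.  If not, the nodes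
-- all of whose initial segments are not Laver-large form a Hechler
-- subtree avoiding X: at such a node only finitely many successors are
-- Laver-large.  Both alternatives cannot hold, and more generally a Laver
-- subtree shares a leaf with any finitely many Hechler subtrees: by
-- induction on T, a Laver subtree has infinitely many successors of the
-- root, the Hechler subtrees jointly miss only finitely many of them, and
-- below a successor kept by all of them the induction hypothesis applies.
-- The same fact gives (2): a Laver subtree inside X meets every member of
-- 𝓕(T), while a Hechler subtree avoiding X yields a member of 𝓕(T)
-- disjoint from X.

open import Defs
open import Level using (0ℓ; _⊔_; Lift; lift; lower) renaming (suc to lsuc)
open import Axiom.ExcludedMiddle using (ExcludedMiddle)
open import Axiom.DoubleNegationElimination using (DoubleNegationElimination; em⇒dne)
open import Data.Product using (Σ; _×_; _,_; proj₁; proj₂; ∃)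
open import Data.Sum using (_⊎_; inj₁; inj₂)
import Data.Sum as Sum
open import Data.Empty using (⊥; ⊥-elim)
open import Data.Unit using (tt)
open import Data.Nat using (ℕ; _<_; _+_)
open import Data.Nat.Properties using (<-≤-trans; m≤m+n; m≤n+m; _<?_; m+n≮n; m+n≮m)
open import Data.Fin using (Fin; zero; suc)
open import Data.List using (List; []; _∷_; _++_; _∷ʳ_; [_])
open import Data.List.Properties using (++-identityʳ)
open import Function using (_∘_)
open import Function.Bundles using (_⇔_; mk⇔)
open import Relation.Binary.PropositionalEquality using (subst)
open import Relation.Nullary using (¬_)
open import Relation.Nullary.Decidable using (yes; no; map′; decidable-stable)

em-lower : ∀ {a} b → ExcludedMiddle (a ⊔ b) → ExcludedMiddle a
em-lower b em = map′ lower lift (em {Lift b _})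

¬¬-∀-Fin : ∀ {k} {P : Fin k → Set} → (∀ i → ¬ ¬ P i) → ¬ ¬ (∀ i → P i)
¬¬-∀-Fin {ℕ.zero}  h ¬all = ¬all λ ()
¬¬-∀-Fin {ℕ.suc k} h ¬all =
  h zero λ p₀ → ¬¬-∀-Fin (h ∘ suc) λ pₛ → ¬all λ { zero → p₀ ; (suc i) → pₛ i }

finite-¬¬ : {P : ℕ → Set} → Finite P → Finite (λ n → ¬ ¬ P n)
finite-¬¬ (m , bound) = m , λ n ¬¬p →
  decidable-stable (n <? m) (λ n≮m → ¬¬p (n≮m ∘ bound n))

finite-⋃ : ∀ {k} (P : Fin k → ℕ → Set) → (∀ i → Finite (P i)) →
  Finite (λ n → ∃ λ i → P i n)
finite-⋃ {ℕ.zero}  P fin = 0 , λ { n (() , _) }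
finite-⋃ {ℕ.suc k} P fin with fin zero | finite-⋃ (P ∘ suc) (fin ∘ suc)
... | m , bound₀ | M , boundₛ = m + M , λ
  { n (zero  , p) → <-≤-trans (bound₀ n p) (m≤m+n m M)
  ; n (suc i , p) → <-≤-trans (boundₛ n (i , p)) (m≤n+m M m) }

infinite-mono : {P R : ℕ → Set} → (∀ {n} → P n → R n) → Infinite P → Infinite R
infinite-mono P⊆R inf (m , bound) = inf (m , λ n → bound n ∘ P⊆R)

cofinite⇒infinite : {P : ℕ → Set} → Finite (λ n → ¬ P n) → Infinite P
cofinite⇒infinite (m , ¬bound) (m′ , bound) =
  m+n≮m m m′ (¬bound (m + m′) (m+n≮n m m′ ∘ bound (m + m′)))

_⇂_ : Pred → List ℕ → Pred
(S ⇂ p) q = S (p ++ q)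

subtree-root : ∀ {T S} → IsSubtree T S → S []
subtree-root ((p , s) , _ , closed) = closed [] p s

laver-⇂ : ∀ {f S} n → IsLaver (node f) S → S [ n ] → IsLaver (f n) (S ⇂ [ n ])
laver-⇂ n ((_ , ⊆T , closed) , ω , leaves) s =
  (([] , s) , ⊆T ∘ (n ∷_) , closed ∘ (n ∷_)) , ω ∘ (n ∷_) , leaves ∘ (n ∷_)

hechler-⇂ : ∀ {f S} n → IsHechler (node f) S → S [ n ] → IsHechler (f n) (S ⇂ [ n ])
hechler-⇂ n (laver , cofinite) s = laver-⇂ n laver s , cofinite ∘ (n ∷_)

CommonLeaf : Pred → ∀ {k} → (Fin k → Pred) → Set
CommonLeaf S Hs = ∃ λ p → LeafIn S p × (∀ i → LeafIn (Hs i) p)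

laver-meets-hechlers : ∀ T {S k} (Hs : Fin k → Pred) →
  IsLaver T S → (∀ i → IsHechler T (Hs i)) → ¬ ¬ CommonLeaf S Hs
laver-meets-hechlers leaf Hs (subS , _) hs none =
  none ([] , leafRoot subS , λ i → leafRoot (proj₁ (proj₁ (hs i))))
  where
  leafRoot : ∀ {S} → IsSubtree leaf S → LeafIn S []
  leafRoot sub@(_ , ⊆T , _) = subtree-root sub , λ n → ⊆T [ n ]
laver-meets-hechlers (node f) {S} Hs lS@(subS , ω , leaves) hs none
  with ω [] (subtree-root subS)
... | inj₁ rootIsLeaf = leaves [] (subtree-root subS , rootIsLeaf)
... | inj₂ infinite = infinite (M , belowM)
  where
  missed : Finite (λ n → ∃ λ i → NodeOf (node f) [ n ] × ¬ Hs i [ n ])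
  missed = finite-⋃ _ λ i → proj₂ (hs i) [] (subtree-root (proj₁ (proj₁ (hs i))))
  M = proj₁ missed
  -- n < M is decidable, and for n ≥ M each Hs i keeps [ n ] up to double negation.
  belowM : ∀ n → S [ n ] → n < M
  belowM n s = decidable-stable (n <? M) λ n≮M →
    ¬¬-∀-Fin (λ i ¬h → n≮M (proj₂ missed n (i , tt , ¬h))) λ h →
    laver-meets-hechlers (f n) (λ i → Hs i ⇂ [ n ]) (laver-⇂ n lS s)
      (λ i → hechler-⇂ n (hs i) (h i))
      (λ (p , l , ls) → none (n ∷ p , l , ls))

-- Along Q T X p: p is a node of T and Q holds of the subtree of T and the
-- part of X below every initial segment of p.
Along : (Tree → Pred → Set) → Tree → Pred → Pred
Along Q T        X []      = Q T X
Along Q leaf     X (n ∷ p) = ⊥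
Along Q (node f) X (n ∷ p) = Q (node f) X × Along Q (f n) (X ⇂ [ n ]) p

module _ {Q : Tree → Pred → Set} where

  along-root : ∀ T X p → Along Q T X p → Q T X
  along-root T        X []      q       = q
  along-root (node f) X (n ∷ p) (q , _) = q

  along-node : ∀ T X p → Along Q T X p → NodeOf T p
  along-node T        X []      _       = tt
  along-node (node f) X (n ∷ p) (_ , a) = along-node (f n) (X ⇂ [ n ]) p a

  along-prefix : ∀ T X p q → Along Q T X (p ++ q) → Along Q T X p
  along-prefix T        X []      q a       = along-root T X q a
  along-prefix (node f) X (n ∷ p) q (r , a) = r , along-prefix (f n) (X ⇂ [ n ]) p q a

  along-subtree : ∀ T X → Q T X → IsSubtree T (Along Q T X)
  along-subtree T X q = ([] , q) , along-node T X , along-prefix T X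

  Expanding CofinitelyExpanding : Set₁
  Expanding = ∀ f X → Q (node f) X → Infinite (λ n → Q (f n) (X ⇂ [ n ]))
  CofinitelyExpanding = ∀ f X → Q (node f) X → Finite (λ n → ¬ Q (f n) (X ⇂ [ n ]))

  along-ω : Expanding → ∀ T X → OmegaBranching (Along Q T X)
  along-ω exp leaf     X []      _       = inj₁ λ _ ()
  along-ω exp (node f) X []      q       = inj₂ (infinite-mono (q ,_) (exp f X q))
  along-ω exp (node f) X (n ∷ p) (q , a) =
    Sum.map (λ noSucc k → noSucc k ∘ proj₂) (infinite-mono (q ,_))
      (along-ω exp (f n) (X ⇂ [ n ]) p a)

  along-leaf : Expanding → ∀ T X p → LeafIn (Along Q T X) p → LeafOf T p × Q leaf (X ⇂ p)
  along-leaf exp leaf     X []      (q , _)       = tt , q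
  along-leaf exp (node f) X []      (q , noSucc)  =
    ⊥-elim (exp f X q (0 , λ n c → ⊥-elim (noSucc n (q , c))))
  along-leaf exp (node f) X (n ∷ p) ((q , a) , noSucc) =
    along-leaf exp (f n) (X ⇂ [ n ]) p (a , λ k c → noSucc k (q , c))

  along-laver : Expanding → ∀ T X → Q T X → IsLaver T (Along Q T X)
  along-laver exp T X q =
    along-subtree T X q , along-ω exp T X , λ p → proj₁ ∘ along-leaf exp T X p

  along-cofinite : CofinitelyExpanding → ∀ T X p → Along Q T X p →
    Finite (λ n → NodeOf T (p ∷ʳ n) × ¬ Along Q T X (p ∷ʳ n))
  along-cofinite cof leaf     X []      _ = 0 , λ { _ (() , _) }
  along-cofinite cof (node f) X []      q with cof f X q
  ... | m , bound = m , λ n (_ , ¬a) → bound n (¬a ∘ (q ,_))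
  along-cofinite cof (node f) X (n ∷ p) (q , a) with along-cofinite cof (f n) (X ⇂ [ n ]) p a
  ... | m , bound = m , λ k (t , ¬a) → bound k (t , ¬a ∘ (q ,_))

  cofinitelyExpanding⇒expanding : CofinitelyExpanding → Expanding
  cofinitelyExpanding⇒expanding cof f X = cofinite⇒infinite ∘ cof f X

  along-hechler : CofinitelyExpanding → ∀ T X → Q T X → IsHechler T (Along Q T X)
  along-hechler cof T X q =
    along-laver (cofinitelyExpanding⇒expanding cof) T X q , along-cofinite cof T X

LaverLarge : Tree → Pred → Set
LaverLarge leaf     X = X []
LaverLarge (node f) X = Infinite (λ n → LaverLarge (f n) (X ⇂ [ n ]))

LaverSmall : Tree → Pred → Set
LaverSmall T X = ¬ LaverLarge T X

LaverInside HechlerOutside : Tree → Pred → Set₁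
LaverInside    T X = Σ Pred λ S → IsLaver T S × (∀ p → LeafIn S p → X p)
HechlerOutside T X = Σ Pred λ S → IsHechler T S × (∀ p → LeafIn S p → X p → ⊥)

laverLarge-expanding : Expanding {LaverLarge}
laverLarge-expanding f X large = large

laverSmall-cofinitelyExpanding : DoubleNegationElimination 0ℓ →
  CofinitelyExpanding {LaverSmall}
laverSmall-cofinitelyExpanding dne f X ¬large = finite-¬¬ (dne ¬large)

laverInside⊎hechlerOutside : ExcludedMiddle 0ℓ → ∀ T X →
  LaverInside T X ⊎ HechlerOutside T X
laverInside⊎hechlerOutside em T X with em {LaverLarge T X}
... | yes large = inj₁ (Along LaverLarge T X , along-laver laverLarge-expanding T X large ,
  λ p → subst X (++-identityʳ p) ∘ proj₂ ∘ along-leaf laverLarge-expanding T X p)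
... | no ¬large = inj₂ (Along LaverSmall T X , along-hechler cof T X ¬large ,
  λ p → subst (λ q → ¬ X q) (++-identityʳ p) ∘ proj₂ ∘ along-leaf exp T X p)
  where
  cof : CofinitelyExpanding {LaverSmall}
  cof = laverSmall-cofinitelyExpanding (em⇒dne em)
  exp : Expanding {LaverSmall}
  exp = cofinitelyExpanding⇒expanding {LaverSmall} cof

¬[laverInside×hechlerOutside] : ∀ T X → ¬ (LaverInside T X × HechlerOutside T X)
¬[laverInside×hechlerOutside] T X ((S , lS , S⊆X) , (H , hH , H∩X=∅)) =
  laver-meets-hechlers T {k = 1} (λ _ → H) lS (λ _ → hH)
    λ (p , l , ls) → H∩X=∅ p (ls zero) (S⊆X p l)

filterPlus⇒laverInside : ExcludedMiddle 0ℓ → ∀ T X → InFilterPlus T X → LaverInside T X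
filterPlus⇒laverInside em T X (_ , meets) with laverInside⊎hechlerOutside em T X
... | inj₁ inside = inside
... | inj₂ (H , hH , H∩X=∅)
  with meets (λ p → LeafOf T p × LeafIn H p)
              ((λ _ → proj₁) , 1 , (λ _ → H) , (λ _ → hH) , λ _ t h → t , h zero)
... | p , x , (_ , l) = ⊥-elim (H∩X=∅ p l x)

laverInside⇒filterPlus : DoubleNegationElimination 0ℓ → ∀ T X → SubsetOfLeaves T X →
  LaverInside T X → InFilterPlus T X
laverInside⇒filterPlus dne T X X⊆L (S , lS@(_ , _ , leaves) , S⊆X) =
  X⊆L , λ Y (_ , _ , Hs , hs , Y⊇⋂) → dne λ disjoint →
    laver-meets-hechlers T Hs lS hs
      λ (p , l , ls) → disjoint (p , S⊆X p l , Y⊇⋂ p (leaves p l) ls)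

mainTheorem8 : ExcludedMiddle (lsuc 0ℓ) →
    (T : Tree) (X : Pred) → SubsetOfLeaves T X →
    ExactlyOne
      (Σ Pred λ S → IsLaver T S × (∀ p → LeafIn S p → X p))
      (Σ Pred λ S → IsHechler T S × (∀ p → LeafIn S p → X p → ⊥))
    × (InFilterPlus T X ⇔ (Σ Pred λ S → IsLaver T S × (∀ p → LeafIn S p → X p)))
mainTheorem8 em T X X⊆L =
  (laverInside⊎hechlerOutside em₀ T X , ¬[laverInside×hechlerOutside] T X) ,
  mk⇔ (filterPlus⇒laverInside em₀ T X) (laverInside⇒filterPlus (em⇒dne em₀) T X X⊆L)
  where
  em₀ : ExcludedMiddle 0ℓ
  em₀ = em-lower {0ℓ} (lsuc 0ℓ) em
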